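{- For every integer $n\ge 3$, the musical graph $M_n$ satisfies $Z_+(M_n)=n+2$.
   Context: The musical graph $M_n$ ($n\ge3$) is the Cayley graph $\mathrm{Cay}(\mathbb{Z}_{2n},\{\pm1,\pm(n-1),n\})$: vertex set $\mathbb{Z}_{2n}$, with $a\sim b$ iff $a-b\in\{\pm1,\pm(n-1),n\}$. Positive zero forcing: a set $B$ of vertices is coloured black, the rest white; if $W_1,\dots,W_k$ are the vertex sets of the components of $G-B$ ($B$ the current black set), $u\in B$, and $w$ is the only white neighbour of $u$ in $G[W_i\cup B]$, then $w$ may be coloured black. $S$ is a positive zero forcing set if starting from $S$ black all vertices eventually become black; $Z_+(G)$ is the minimum size of such a set. -}

module Defs where

open import Data.Nat using (ℕ; _+_; _*_; _∸_)
open import Data.Fin using (Fin; toℕ)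
open import Data.Fin.Subset using (Subset; _∈_; _∉_; _∪_; ⁅_⁆; ⊤; ∣_∣)
open import Data.Product using (Σ; ∃; _×_)
open import Data.Sum using (_⊎_)
open import Relation.Binary.PropositionalEquality using (_≡_)
open import Relation.Binary.Construct.Closure.ReflexiveTransitive using (Star)

Cong : ℕ → ℕ → ℕ → Set
Cong m x y = ∃ λ k → (x ≡ y + k * m) ⊎ (y ≡ x + k * m)

-- The musical graph M_n = Cay(ℤ_{2n}, {±1, ±(n-1), n}), vertices Fin (2n)
-- (vertex i represents the residue i mod 2n).
-- a ~ b iff b - a ∈ {1, -1, n-1, -(n-1), n} (mod 2n).
MAdj : (n : ℕ) → Fin (2 * n) → Fin (2 * n) → Set
MAdj n a b =
    (Cong (2 * n) (toℕ b + 1) (toℕ a))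
  ⊎ (Cong (2 * n) (toℕ a + 1) (toℕ b))
  ⊎ (Cong (2 * n) (toℕ b + (n ∸ 1)) (toℕ a))
  ⊎ (Cong (2 * n) (toℕ a + (n ∸ 1)) (toℕ b))
  ⊎ (Cong (2 * n) (toℕ a + n) (toℕ b))

module PZF {m : ℕ} (Adj : Fin m → Fin m → Set) where

  WhiteEdge : Subset m → Fin m → Fin m → Set
  WhiteEdge B x y = x ∉ B × y ∉ B × Adj x y

  SameComp : Subset m → Fin m → Fin m → Set
  SameComp B = Star (WhiteEdge B)

  -- Positive zero forcing rule: u black, w white adjacent to u, and w is the
  -- only white neighbour of u in G[W ∪ B], W the component of G - B containing w.
  Forces : Subset m → Fin m → Fin m → Set
  Forces B u w = u ∈ B × w ∉ B × Adj u w
    × (∀ w′ → w′ ∉ B → Adj u w′ → SameComp B w w′ → w′ ≡ w)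

  Step : Subset m → Subset m → Set
  Step B B′ = Σ (Fin m) λ u → Σ (Fin m) λ w → Forces B u w × B′ ≡ B ∪ ⁅ w ⁆

  IsPZFS : Subset m → Set
  IsPZFS S = Star Step S ⊤

  ZPlusIs : ℕ → Set
  ZPlusIs k = (Σ (Subset m) λ S → IsPZFS S × ∣ S ∣ ≡ k)
            × (∀ S → IsPZFS S → k Data.Nat.≤ ∣ S ∣)

-- M_n is the lexicographic product C_n[K_2]: the vertices t and t + n form a pair, and
-- two distinct vertices are adjacent exactly when their pairs are equal or consecutive
-- modulo n.  Lower bound: let S have at most n + 1 vertices.  If some pair is entirely
-- white, its two vertices are twins, and neither can be forced while the other is white.
-- Otherwise every pair meets S, so by counting at most one pair lies inside S; then a
-- black vertex u with a white neighbour w always has a second white neighbour in the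
-- component of w (the other vertex of u's pair, or a vertex of a pair next to u's, the
-- two pairs next to u's being joined around the cycle of pairs), so S forces nothing.
-- Upper bound: starting from {0, …, n + 1}, the vertex 1 + j forces 2 + j + n.
module Submission where

open import Defs
open import Data.Nat using (ℕ; _+_; _*_; _≤_)
open import Data.Nat.Base using (zero; suc; _<_; _∸_; _/_; _%_; z≤n; s≤s; z<s; NonZero)
open import Data.Nat.Properties
open import Data.Nat.DivMod
open import Data.Nat.Divisibility using (divides)
open import Data.Nat.Tactic.RingSolver using (solve-∀)
open import Data.Fin.Base using (Fin; zero; suc; toℕ; fromℕ<; _↑ˡ_; _↑ʳ_)
open import Data.Fin.Properties using (toℕ-injective; toℕ<n; toℕ-fromℕ<; toℕ-↑ˡ; toℕ-↑ʳ; any?)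
  renaming (_≟_ to _≟ᶠ_)
open import Data.Fin.Subset using (Subset; _∈_; _∉_; _∪_; _∩_; ⁅_⁆; ⊤; ∣_∣; inside; outside)
open import Data.Fin.Subset.Properties
  using (_∈?_; ∈⊤; ∣⊤∣≡n; p⊆q⇒∣p∣≤∣q∣; x∈p∪q⁺; x∈p∪q⁻; x∈p∩q⁺; ∪-identityʳ; x∈⁅y⁆⇒x≡y;
         x∈p∧x≢y⇒x∈p-y; x∈p⇒∣p-x∣<∣p∣)
open import Data.Vec.Base using ([]; _∷_; _++_; splitAt; here; there)
open import Data.Product using (∃; _×_; _,_)
open import Data.Sum using (_⊎_; inj₁; inj₂; [_,_])
open import Data.Empty using (⊥; ⊥-elim)
open import Function.Base using (_∘_)
open import Relation.Nullary using (¬_; Dec; yes; no)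
open import Relation.Nullary.Decidable using (_×-dec_; ¬?)
open import Relation.Binary.PropositionalEquality
  using (_≡_; _≢_; refl; sym; trans; cong; cong₂; subst; module ≡-Reasoning)
open import Relation.Binary.Construct.Closure.ReflexiveTransitive using (Star; ε; _◅_; _◅◅_)
import Relation.Binary.Construct.Closure.ReflexiveTransitive as Star

-- Congruences

even-or-odd : ∀ q → ∃ λ r → q ≡ r * 2 ⊎ q ≡ 1 + r * 2
even-or-odd zero = 0 , inj₁ refl
even-or-odd (suc zero) = 0 , inj₂ refl
even-or-odd (suc (suc q)) with even-or-odd q
... | r , inj₁ q≡ = suc r , inj₁ (cong (2 +_) q≡)
... | r , inj₂ q≡ = suc r , inj₂ (cong (2 +_) q≡)

module _ {d : ℕ} .{{_ : NonZero d}} where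

  Cong⇒% : ∀ {a b} → Cong d a b → a % d ≡ b % d
  Cong⇒% {a} {b} (q , inj₁ a≡) = trans (cong (_% d) a≡) ([m+kn]%n≡m%n b q d)
  Cong⇒% {a} {b} (q , inj₂ b≡) = sym (trans (cong (_% d) b≡) ([m+kn]%n≡m%n a q d))

  private
    %⇒≡+* : ∀ {a b} → a % d ≡ b % d → b / d ≤ a / d → a ≡ b + (a / d ∸ b / d) * d
    %⇒≡+* {a} {b} eq le = begin
      a                                       ≡⟨ m≡m%n+[m/n]*n a d ⟩
      a % d + a / d * d                       ≡⟨ cong₂ (λ r q → r + q * d) eq (sym (m∸n+n≡m le)) ⟩
      b % d + (a / d ∸ b / d + b / d) * d     ≡⟨ regroup (b % d) (a / d ∸ b / d) (b / d) d ⟩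
      b % d + b / d * d + (a / d ∸ b / d) * d ≡⟨ cong (_+ (a / d ∸ b / d) * d) (sym (m≡m%n+[m/n]*n b d)) ⟩
      b + (a / d ∸ b / d) * d                 ∎
      where
      open ≡-Reasoning
      regroup : ∀ r p q d → r + (p + q) * d ≡ r + q * d + p * d
      regroup = solve-∀

  %⇒Cong : ∀ {a b} → a % d ≡ b % d → Cong d a b
  %⇒Cong {a} {b} eq with ≤-total (b / d) (a / d)
  ... | inj₁ le = a / d ∸ b / d , inj₁ (%⇒≡+* eq le)
  ... | inj₂ le = b / d ∸ a / d , inj₂ (%⇒≡+* (sym eq) le)

  %-+ʳ : ∀ {a b} c → a % d ≡ b % d → (a + c) % d ≡ (b + c) % d
  %-+ʳ {a} {b} c eq = begin
    (a + c) % d         ≡⟨ %-distribˡ-+ a c d ⟩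
    (a % d + c % d) % d ≡⟨ cong (λ r → (r + c % d) % d) eq ⟩
    (b % d + c % d) % d ≡⟨ %-distribˡ-+ b c d ⟨
    (b + c) % d         ∎
    where open ≡-Reasoning

  %-shift : ∀ {a b c c′} → (b + c) % d ≡ a % d → c + c′ ≡ d → b % d ≡ (a + c′) % d
  %-shift {a} {b} {c} {c′} eq c+c′≡d = begin
    b % d            ≡⟨ [m+n]%n≡m%n b d ⟨
    (b + d) % d      ≡⟨ cong (λ e → (b + e) % d) c+c′≡d ⟨
    (b + (c + c′)) % d ≡⟨ cong (_% d) (+-assoc b c c′) ⟨
    (b + c + c′) % d ≡⟨ %-+ʳ c′ eq ⟩
    (a + c′) % d     ∎
    where open ≡-Reasoning

  [a+c]%d≢a%d : ∀ a {c} → 0 < c → c < d → (a + c) % d ≢ a % d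
  [a+c]%d≢a%d a {c} 0<c c<d eq with %⇒Cong eq
  ... | q , inj₁ a+c≡ = not-multiple q (+-cancelˡ-≡ a c (q * d) a+c≡)
    where
    not-multiple : ∀ q → c ≢ q * d
    not-multiple zero c≡0 = <⇒≢ 0<c (sym c≡0)
    not-multiple (suc q) c≡ = <⇒≱ c<d (subst (d ≤_) (sym c≡) (m≤m+n d (q * d)))
  ... | q , inj₂ a≡ = <⇒≢ 0<c (sym (m+n≡0⇒m≡0 c (sym (+-cancelˡ-≡ a 0 (c + q * d)
                        (trans (+-identityʳ a) (trans a≡ (+-assoc a c (q * d))))))))

module _ {d : ℕ} .{{_ : NonZero d}} where
  private instance
    2d≢0 : NonZero (2 * d)
    2d≢0 = m*n≢0 2 d

  %-lift : ∀ a b → a % d ≡ b % d → a % (2 * d) ≡ b % (2 * d) ⊎ a % (2 * d) ≡ (b + d) % (2 * d)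
  %-lift a b eq = lift (%⇒Cong eq)
    where
    even : ∀ x r d → x + r * 2 * d ≡ x + r * (2 * d)
    even = solve-∀
    odd : ∀ x r d → x + (1 + r * 2) * d ≡ x + d + r * (2 * d)
    odd = solve-∀
    odd+ : ∀ x r d → x + (1 + r * 2) * d + d ≡ x + suc r * (2 * d)
    odd+ = solve-∀
    lift : Cong d a b → a % (2 * d) ≡ b % (2 * d) ⊎ a % (2 * d) ≡ (b + d) % (2 * d)
    lift (q , inj₁ a≡) with even-or-odd q
    ... | r , inj₁ refl = inj₁ (Cong⇒% {2 * d} (r , inj₁ (trans a≡ (even b r d))))
    ... | r , inj₂ refl = inj₂ (Cong⇒% {2 * d} (r , inj₁ (trans a≡ (odd b r d))))
    lift (q , inj₂ b≡) with even-or-odd q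
    ... | r , inj₁ refl = inj₁ (Cong⇒% {2 * d} (r , inj₂ (trans b≡ (even a r d))))
    ... | r , inj₂ refl = inj₂ (Cong⇒% {2 * d} (suc r , inj₂ (trans (cong (_+ d) b≡) (odd+ a r d))))

-- Subsets of Fin v

∣p++q∣≡∣p∣+∣q∣ : ∀ {a b} (p : Subset a) (q : Subset b) → ∣ p ++ q ∣ ≡ ∣ p ∣ + ∣ q ∣
∣p++q∣≡∣p∣+∣q∣ [] q = refl
∣p++q∣≡∣p∣+∣q∣ (inside ∷ p) q = cong suc (∣p++q∣≡∣p∣+∣q∣ p q)
∣p++q∣≡∣p∣+∣q∣ (outside ∷ p) q = ∣p++q∣≡∣p∣+∣q∣ p q

∣p∪q∣+∣p∩q∣≡∣p∣+∣q∣ : ∀ {a} (p q : Subset a) → ∣ p ∪ q ∣ + ∣ p ∩ q ∣ ≡ ∣ p ∣ + ∣ q ∣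
∣p∪q∣+∣p∩q∣≡∣p∣+∣q∣ [] [] = refl
∣p∪q∣+∣p∩q∣≡∣p∣+∣q∣ (inside ∷ p) (inside ∷ q) =
  cong suc (trans (+-suc _ _) (trans (cong suc (∣p∪q∣+∣p∩q∣≡∣p∣+∣q∣ p q)) (sym (+-suc _ _))))
∣p∪q∣+∣p∩q∣≡∣p∣+∣q∣ (inside ∷ p) (outside ∷ q) = cong suc (∣p∪q∣+∣p∩q∣≡∣p∣+∣q∣ p q)
∣p∪q∣+∣p∩q∣≡∣p∣+∣q∣ (outside ∷ p) (inside ∷ q) =
  trans (cong suc (∣p∪q∣+∣p∩q∣≡∣p∣+∣q∣ p q)) (sym (+-suc _ _))
∣p∪q∣+∣p∩q∣≡∣p∣+∣q∣ (outside ∷ p) (outside ∷ q) = ∣p∪q∣+∣p∩q∣≡∣p∣+∣q∣ p q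

2≤∣p∣ : ∀ {a} {p : Subset a} {x y} → x ∈ p → y ∈ p → x ≢ y → 2 ≤ ∣ p ∣
2≤∣p∣ x∈p y∈p x≢y =
  ≤-trans (s≤s (≤-trans (s≤s z≤n) (x∈p⇒∣p-x∣<∣p∣ (x∈p∧x≢y⇒x∈p-y y∈p (x≢y ∘ sym)))))
          (x∈p⇒∣p-x∣<∣p∣ x∈p)

∉-∪⁅⁆ : ∀ {v} {B : Subset v} {x w} → x ∉ B → x ≢ w → x ∉ B ∪ ⁅ w ⁆
∉-∪⁅⁆ {B = B} {x} {w} x∉B x≢w x∈ with x∈p∪q⁻ B ⁅ w ⁆ x∈
... | inj₁ x∈B = x∉B x∈B
... | inj₂ x∈w = x≢w (x∈⁅y⁆⇒x≡y w x∈w)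

↑ˡ∈++⁻ : ∀ {a b} {p : Subset a} {q : Subset b} {i} → i ↑ˡ b ∈ p ++ q → i ∈ p
↑ˡ∈++⁻ {p = _ ∷ _} {i = zero} here = here
↑ˡ∈++⁻ {p = _ ∷ _} {i = suc i} (there i∈) = there (↑ˡ∈++⁻ i∈)

↑ʳ∈++⁻ : ∀ {a b} {p : Subset a} {q : Subset b} {j} → a ↑ʳ j ∈ p ++ q → j ∈ q
↑ʳ∈++⁻ {p = []} j∈ = j∈
↑ʳ∈++⁻ {p = _ ∷ _} (there j∈) = ↑ʳ∈++⁻ j∈

below : ∀ v → ℕ → Subset v
below zero _ = []
below (suc v) zero = outside ∷ below v zero
below (suc v) (suc c) = inside ∷ below v c

∈below : ∀ {v c} {x : Fin v} → toℕ x < c → x ∈ below v c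
∈below {suc v} {suc c} {zero} _ = here
∈below {suc v} {suc c} {suc x} (s≤s x<c) = there (∈below x<c)

∈below⁻ : ∀ {v c} {x : Fin v} → x ∈ below v c → toℕ x < c
∈below⁻ {suc v} {suc c} {zero} _ = s≤s z≤n
∈below⁻ {suc v} {zero} {suc x} (there x∈) = ⊥-elim (<⇒≱ (∈below⁻ x∈) z≤n)
∈below⁻ {suc v} {suc c} {suc x} (there x∈) = s≤s (∈below⁻ x∈)

∣below∣ : ∀ {v c} → c ≤ v → ∣ below v c ∣ ≡ c
∣below∣ {v} {zero} _ = ∣below-zero∣ v
  where
  ∣below-zero∣ : ∀ v → ∣ below v 0 ∣ ≡ 0
  ∣below-zero∣ zero = refl
  ∣below-zero∣ (suc v) = ∣below-zero∣ v
∣below∣ {suc v} {suc c} (s≤s c≤v) = cong suc (∣below∣ c≤v)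

below-all : ∀ v → below v v ≡ ⊤
below-all zero = refl
below-all (suc v) = cong (inside ∷_) (below-all v)

below-suc : ∀ {v c} (x : Fin v) → toℕ x ≡ c → below v (suc c) ≡ below v c ∪ ⁅ x ⁆
below-suc {suc v} zero refl = cong (inside ∷_) (sym (∪-identityʳ (below v 0)))
below-suc {suc v} (suc x) refl = cong (inside ∷_) (below-suc x refl)

-- Positive zero forcing

module PZFProperties {v : ℕ} (Adj : Fin v → Fin v → Set) where
  open PZF Adj

  white-edge : ∀ {B x y} → x ∉ B → y ∉ B → Adj x y → SameComp B x y
  white-edge x∉B y∉B x~y = (x∉B , y∉B , x~y) ◅ ε

  SameComp-sym : (∀ {x y} → Adj x y → Adj y x) → ∀ {B x y} → SameComp B x y → SameComp B y x
  SameComp-sym adj-sym = Star.reverse λ (x∉B , y∉B , x~y) → y∉B , x∉B , adj-sym x~y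

  ¬Forces-rival : ∀ {B u w y} → y ≢ w → y ∉ B → Adj u y → SameComp B w y → ¬ Forces B u w
  ¬Forces-rival y≢w y∉B u~y w⇝y (_ , _ , _ , unique) = y≢w (unique _ y∉B u~y w⇝y)

  Twins : Fin v → Fin v → Set
  Twins x y = x ≢ y × Adj x y × (∀ {u} → u ≢ y → Adj u x → Adj u y)

  twin-unforceable : ∀ {B u x y} → Twins x y → y ∉ B → ¬ Forces B u x
  twin-unforceable (x≢y , x~y , shared) y∉B f@(u∈B , x∉B , u~x , _) =
    ¬Forces-rival (x≢y ∘ sym) y∉B (shared (λ { refl → y∉B u∈B }) u~x) (white-edge x∉B y∉B x~y) f

  white-twins-never-black : ∀ {B x y} → Twins x y → Twins y x → x ∉ B → y ∉ B → ¬ Star Step B ⊤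
  white-twins-never-black xy yx x∉B y∉B ε = x∉B ∈⊤
  white-twins-never-black xy yx x∉B y∉B ((_ , _ , f , refl) ◅ rest) =
    white-twins-never-black xy yx
      (∉-∪⁅⁆ x∉B λ { refl → twin-unforceable xy y∉B f })
      (∉-∪⁅⁆ y∉B λ { refl → twin-unforceable yx x∉B f }) rest

  no-forces⇒⊤ : ∀ {B} → (∀ {u w} → ¬ Forces B u w) → Star Step B ⊤ → B ≡ ⊤
  no-forces⇒⊤ stuck ε = refl
  no-forces⇒⊤ stuck ((_ , _ , f , _) ◅ _) = ⊥-elim (stuck f)

-- The musical graph

module Musical (k : ℕ) where
  m n N : ℕ
  m = 2 + k
  n = suc m
  N = 2 * n

  open PZF (MAdj n)
  open PZFProperties (MAdj n)

  -- Congruence modulo n, i.e. lying in the same pair; a record so that its indices can be inferred.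
  infix 4 _≈_
  record _≈_ (a b : ℕ) : Set where
    constructor mk≈
    field
      %≡ : a % n ≡ b % n
  open _≈_

  ≡⇒≈ : ∀ {a b} → a ≡ b → a ≈ b
  ≡⇒≈ refl = mk≈ refl

  ≈-sym : ∀ {a b} → a ≈ b → b ≈ a
  ≈-sym (mk≈ eq) = mk≈ (sym eq)

  ≈-trans : ∀ {a b c} → a ≈ b → b ≈ c → a ≈ c
  ≈-trans (mk≈ eq) (mk≈ eq′) = mk≈ (trans eq eq′)

  _≈?_ : ∀ a b → Dec (a ≈ b)
  a ≈? b with a % n ≟ b % n
  ... | yes eq = yes (mk≈ eq)
  ... | no neq = no (neq ∘ %≡)

  ≈-+ʳ : ∀ {a b} c → a ≈ b → a + c ≈ b + c
  ≈-+ʳ {a} {b} c (mk≈ eq) = mk≈ (%-+ʳ {n} {a} {b} c eq)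

  ≈-shift : ∀ {a b c c′} → b + c ≈ a → c + c′ ≡ n → b ≈ a + c′
  ≈-shift {a} {b} {c} {c′} (mk≈ eq) c+c′≡n = mk≈ (%-shift {n} {a} {b} {c} {c′} eq c+c′≡n)

  +n≈ : ∀ a → a + n ≈ a
  +n≈ a = mk≈ ([m+n]%n≡m%n a n)

  +≉ : ∀ a {d} → 0 < d → d < n → ¬ a + d ≈ a
  +≉ a 0<d d<n (mk≈ eq) = [a+c]%d≢a%d a 0<d d<n eq

  1<n : 1 < n
  1<n = s≤s (s≤s z≤n)

  n<N : n < N
  n<N = m<m+n n z<s

  1+n+m≡N : 1 + n + m ≡ N
  1+n+m≡N = trans (sym (+-suc n m)) (cong (n +_) (sym (+-identityʳ n)))

  m+n+1≡N : m + n + 1 ≡ N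
  m+n+1≡N = trans (+-comm (m + n) 1) (cong (n +_) (sym (+-identityʳ n)))

  toℕ%N : ∀ (x : Fin N) → toℕ x % N ≡ toℕ x
  toℕ%N x = m<n⇒m%n≡m (toℕ<n x)

  Cong⇒≈ : ∀ {a b} → Cong N a b → a ≈ b
  Cong⇒≈ {a} {b} c = mk≈ (begin
    a % n     ≡⟨ m∣n⇒o%n%m≡o%m n N a (divides 2 refl) ⟨
    a % N % n ≡⟨ cong (_% n) (Cong⇒% c) ⟩
    b % N % n ≡⟨ m∣n⇒o%n%m≡o%m n N b (divides 2 refl) ⟩
    b % n     ∎)
    where open ≡-Reasoning

  ≈-cases : ∀ {a b} → a < N → b < n → a ≈ b → a ≡ b ⊎ a ≡ n + b
  ≈-cases {a} {b} a<N b<n (mk≈ eq) with %-lift a b eq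
  ... | inj₁ eq′ = inj₁ (trans (sym (m<n⇒m%n≡m a<N)) (trans eq′ (m<n⇒m%n≡m (<-trans b<n n<N))))
  ... | inj₂ eq′ = inj₂ (trans (sym (m<n⇒m%n≡m a<N)) (trans eq′ (trans (m<n⇒m%n≡m b+n<N) (+-comm b n))))
    where
    b+n<N : b + n < N
    b+n<N = subst (b + n <_) (cong (n +_) (sym (+-identityʳ n))) (+-monoˡ-< n b<n)

  Near : ℕ → ℕ → Set
  Near a b = b ≈ a ⊎ b ≈ a + 1 ⊎ b ≈ a + m

  near-respʳ : ∀ {a b b′} → b ≈ b′ → Near a b → Near a b′
  near-respʳ b≈b′ (inj₁ b≈) = inj₁ (≈-trans (≈-sym b≈b′) b≈)
  near-respʳ b≈b′ (inj₂ (inj₁ b≈)) = inj₂ (inj₁ (≈-trans (≈-sym b≈b′) b≈))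
  near-respʳ b≈b′ (inj₂ (inj₂ b≈)) = inj₂ (inj₂ (≈-trans (≈-sym b≈b′) b≈))

  near-sym : ∀ {a b} → Near a b → Near b a
  near-sym (inj₁ b≈a) = inj₁ (≈-sym b≈a)
  near-sym (inj₂ (inj₁ b≈a+1)) = inj₂ (inj₂ (≈-shift (≈-sym b≈a+1) refl))
  near-sym (inj₂ (inj₂ b≈a+m)) = inj₂ (inj₁ (≈-shift (≈-sym b≈a+m) (+-comm m 1)))

  adj⇒≢ : ∀ {x y} → MAdj n x y → x ≢ y
  adj⇒≢ {x} x~x refl = ¬loop x~x
    where
    ¬self : ∀ {c} → 0 < c → c < N → ¬ Cong N (toℕ x + c) (toℕ x)
    ¬self 0<c c<N h = [a+c]%d≢a%d (toℕ x) 0<c c<N (Cong⇒% h)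
    m<N : m < N
    m<N = <-trans (n<1+n m) n<N
    ¬loop : ¬ MAdj n x x
    ¬loop (inj₁ c) = ¬self z<s (<-trans 1<n n<N) c
    ¬loop (inj₂ (inj₁ c)) = ¬self z<s (<-trans 1<n n<N) c
    ¬loop (inj₂ (inj₂ (inj₁ c))) = ¬self z<s m<N c
    ¬loop (inj₂ (inj₂ (inj₂ (inj₁ c)))) = ¬self z<s m<N c
    ¬loop (inj₂ (inj₂ (inj₂ (inj₂ c)))) = ¬self z<s n<N c

  adj⇒near : ∀ {x y} → MAdj n x y → Near (toℕ x) (toℕ y)
  adj⇒near (inj₁ c) = inj₂ (inj₂ (≈-shift (Cong⇒≈ c) refl))
  adj⇒near (inj₂ (inj₁ c)) = inj₂ (inj₁ (≈-sym (Cong⇒≈ c)))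
  adj⇒near (inj₂ (inj₂ (inj₁ c))) = inj₂ (inj₁ (≈-shift (Cong⇒≈ c) (+-comm m 1)))
  adj⇒near (inj₂ (inj₂ (inj₂ (inj₁ c)))) = inj₂ (inj₂ (≈-sym (Cong⇒≈ c)))
  adj⇒near {x} (inj₂ (inj₂ (inj₂ (inj₂ c)))) = inj₁ (≈-trans (≈-sym (Cong⇒≈ c)) (+n≈ (toℕ x)))

  near⇒adj : ∀ {x y} → x ≢ y → Near (toℕ x) (toℕ y) → MAdj n x y
  near⇒adj {x} {y} x≢y (inj₁ (mk≈ y≈x)) with %-lift (toℕ y) (toℕ x) y≈x
  ... | inj₁ eq = ⊥-elim (x≢y (toℕ-injective (trans (sym (toℕ%N x)) (trans (sym eq) (toℕ%N y)))))
  ... | inj₂ eq = inj₂ (inj₂ (inj₂ (inj₂ (%⇒Cong (sym eq)))))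
  near⇒adj {x} {y} x≢y (inj₂ (inj₁ (mk≈ y≈x+1))) with %-lift (toℕ y) (toℕ x + 1) y≈x+1
  ... | inj₁ eq = inj₂ (inj₁ (%⇒Cong (sym eq)))
  ... | inj₂ eq = inj₂ (inj₂ (inj₁ (%⇒Cong (sym (%-shift {N} {toℕ y} {toℕ x}
                    (trans (cong (_% N) (sym (+-assoc (toℕ x) 1 n))) (sym eq)) 1+n+m≡N)))))
  near⇒adj {x} {y} x≢y (inj₂ (inj₂ (mk≈ y≈x+m))) with %-lift (toℕ y) (toℕ x + m) y≈x+m
  ... | inj₁ eq = inj₂ (inj₂ (inj₂ (inj₁ (%⇒Cong (sym eq)))))
  ... | inj₂ eq = inj₁ (%⇒Cong (sym (%-shift {N} {toℕ y} {toℕ x}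
                    (trans (cong (_% N) (sym (+-assoc (toℕ x) m n))) (sym eq)) m+n+1≡N)))

  adj-sym : ∀ {x y} → MAdj n x y → MAdj n y x
  adj-sym x~y = near⇒adj (adj⇒≢ x~y ∘ sym) (near-sym (adj⇒near x~y))

  adj-resp-≈ : ∀ {x y z} → MAdj n z x → z ≢ y → toℕ y ≈ toℕ x → MAdj n z y
  adj-resp-≈ z~x z≢y y≈x = near⇒adj z≢y (near-respʳ (≈-sym y≈x) (adj⇒near z~x))

  ≈⇒Twins : ∀ {x y} → x ≢ y → toℕ y ≈ toℕ x → Twins x y
  ≈⇒Twins x≢y y≈x = x≢y , near⇒adj x≢y (inj₁ y≈x) , λ u≢y u~x → adj-resp-≈ u~x u≢y y≈x

  ≈-distinct : ∀ {x y : Fin N} {a b} → toℕ x ≈ a → toℕ y ≈ b → ¬ a ≈ b → x ≢ y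
  ≈-distinct x≈a y≈b a≉b refl = a≉b (≈-trans (≈-sym x≈a) y≈b)

  -- Fin N is definitionally Fin (n + (n + 0)), and lo i, hi i are the vertices i and n + i.
  lo hi : Fin n → Fin N
  lo i = i ↑ˡ (n + 0)
  hi i = n ↑ʳ (i ↑ˡ 0)

  toℕ-hi : ∀ i → toℕ (hi i) ≡ n + toℕ i
  toℕ-hi i = trans (toℕ-↑ʳ n (i ↑ˡ 0)) (cong (n +_) (toℕ-↑ˡ i 0))

  lo≈ : ∀ i → toℕ (lo i) ≈ toℕ i
  lo≈ i = ≡⇒≈ (toℕ-↑ˡ i _)

  hi≈ : ∀ i → toℕ (hi i) ≈ toℕ i
  hi≈ i = ≈-trans (≡⇒≈ (trans (toℕ-hi i) (+-comm n (toℕ i)))) (+n≈ (toℕ i))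

  lo≢hi : ∀ i → lo i ≢ hi i
  lo≢hi i lo≡hi = <⇒≢ (≤-trans (toℕ<n i) (m≤m+n n (toℕ i)))
    (trans (sym (toℕ-↑ˡ i _)) (trans (cong toℕ lo≡hi) (toℕ-hi i)))

  pair-members : ∀ {x} i → toℕ x ≈ toℕ i → x ≡ lo i ⊎ x ≡ hi i
  pair-members {x} i x≈i with ≈-cases (toℕ<n x) (toℕ<n i) x≈i
  ... | inj₁ x≡i = inj₁ (toℕ-injective (trans x≡i (sym (toℕ-↑ˡ i _))))
  ... | inj₂ x≡n+i = inj₂ (toℕ-injective (trans x≡n+i (sym (toℕ-hi i))))

  pair : ℕ → Fin n
  pair t = fromℕ< (m%n<n t n)

  pair≈ : ∀ t → toℕ (pair t) ≈ t
  pair≈ t = mk≈ (trans (cong (_% n) (toℕ-fromℕ< (m%n<n t n))) (m%n%n≡m%n t n))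

  FullPair : Subset N → ℕ → Set
  FullPair B t = ∀ {x} → toℕ x ≈ t → x ∈ B

  FullPair-resp : ∀ {B a b} → a ≈ b → FullPair B a → FullPair B b
  FullPair-resp a≈b full x≈b = full (≈-trans x≈b (≈-sym a≈b))

  full-or-white : ∀ B t → FullPair B t ⊎ ∃ λ x → toℕ x ≈ t × x ∉ B
  full-or-white B t with lo (pair t) ∈? B | hi (pair t) ∈? B
  ... | no lo∉ | _ = inj₂ (lo (pair t) , ≈-trans (lo≈ (pair t)) (pair≈ t) , lo∉)
  ... | yes _ | no hi∉ = inj₂ (hi (pair t) , ≈-trans (hi≈ (pair t)) (pair≈ t) , hi∉)
  ... | yes lo∈ | yes hi∈ = inj₁ λ x≈t → member (pair-members (pair t) (≈-trans x≈t (≈-sym (pair≈ t))))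
    where
    member : ∀ {x} → x ≡ lo (pair t) ⊎ x ≡ hi (pair t) → x ∈ B
    member (inj₁ refl) = lo∈
    member (inj₂ refl) = hi∈

  white-in-pair : ∀ {B t} → ¬ FullPair B t → ∃ λ x → toℕ x ≈ t × x ∉ B
  white-in-pair {B} {t} ¬full with full-or-white B t
  ... | inj₁ full = ⊥-elim (¬full full)
  ... | inj₂ white = white

  same-pair-connected : ∀ {B x y} → x ∉ B → y ∉ B → toℕ y ≈ toℕ x → SameComp B x y
  same-pair-connected {x = x} {y} x∉B y∉B y≈x with x ≟ᶠ y
  ... | yes refl = ε
  ... | no x≢y = white-edge x∉B y∉B (near⇒adj x≢y (inj₁ y≈x))

  consecutive-adj : ∀ {x y t} → toℕ x ≈ t → toℕ y ≈ t + 1 → MAdj n x y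
  consecutive-adj {t = t} x≈t y≈t+1 =
    near⇒adj (≈-distinct x≈t y≈t+1 (+≉ t z<s 1<n ∘ ≈-sym)) (inj₂ (inj₁ (≈-trans y≈t+1 (≈-+ʳ 1 (≈-sym x≈t)))))

  pair-path : ∀ {B t x y} j → (∀ {i} → i ≤ j → ¬ FullPair B (t + i)) →
              x ∉ B → toℕ x ≈ t → y ∉ B → toℕ y ≈ t + j → SameComp B x y
  pair-path {t = t} zero _ x∉B x≈t y∉B y≈t+0 =
    same-pair-connected x∉B y∉B (≈-trans y≈t+0 (≈-trans (≡⇒≈ (+-identityʳ t)) (≈-sym x≈t)))
  pair-path {t = t} (suc j) nonfull x∉B x≈t y∉B y≈ with white-in-pair (nonfull (n≤1+n j))
  ... | z , z≈ , z∉B =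
    pair-path j (nonfull ∘ m≤n⇒m≤1+n) x∉B x≈t z∉B z≈
      ◅◅ white-edge z∉B y∉B (consecutive-adj z≈ (≈-trans y≈ (≡⇒≈ (trans (+-suc t j) (+-comm 1 (t + j))))))

  Covered : Subset N → Set
  Covered B = ∀ t → ∃ λ x → toℕ x ≈ t × x ∈ B

  two-full⇒n+2≤∣B∣ : ∀ {B a b} → Covered B → FullPair B a → FullPair B b → ¬ a ≈ b → n + 2 ≤ ∣ B ∣
  two-full⇒n+2≤∣B∣ {B} {a} {b} covered full-a full-b a≉b with splitAt n B
  ... | L , R , refl with splitAt n R
  ... | R₀ , [] , refl = begin
    n + 2                    ≤⟨ +-mono-≤ everywhere (2≤∣p∣ (doubly full-a) (doubly full-b) pa≢pb) ⟩
    ∣ L ∪ R₀ ∣ + ∣ L ∩ R₀ ∣  ≡⟨ ∣p∪q∣+∣p∩q∣≡∣p∣+∣q∣ L R₀ ⟩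
    ∣ L ∣ + ∣ R₀ ∣           ≡⟨ cong (∣ L ∣ +_) (trans (sym (+-identityʳ ∣ R₀ ∣)) (sym (∣p++q∣≡∣p∣+∣q∣ R₀ []))) ⟩
    ∣ L ∣ + ∣ R₀ ++ [] ∣     ≡⟨ ∣p++q∣≡∣p∣+∣q∣ L (R₀ ++ []) ⟨
    ∣ L ++ (R₀ ++ []) ∣      ∎
    where
    open ≤-Reasoning
    lo∈⁻ : ∀ {i} → lo i ∈ L ++ (R₀ ++ []) → i ∈ L
    lo∈⁻ = ↑ˡ∈++⁻
    hi∈⁻ : ∀ {i} → hi i ∈ L ++ (R₀ ++ []) → i ∈ R₀
    hi∈⁻ = ↑ˡ∈++⁻ {q = []} ∘ ↑ʳ∈++⁻ {p = L}
    covered-at : ∀ i → i ∈ L ∪ R₀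
    covered-at i with covered (toℕ i)
    ... | x , x≈i , x∈B with pair-members {x} i x≈i
    ...   | inj₁ refl = x∈p∪q⁺ (inj₁ (lo∈⁻ x∈B))
    ...   | inj₂ refl = x∈p∪q⁺ (inj₂ (hi∈⁻ x∈B))
    everywhere : n ≤ ∣ L ∪ R₀ ∣
    everywhere = subst (_≤ ∣ L ∪ R₀ ∣) (∣⊤∣≡n n) (p⊆q⇒∣p∣≤∣q∣ {p = ⊤} (λ {i} _ → covered-at i))
    doubly : ∀ {t} → FullPair (L ++ (R₀ ++ [])) t → pair t ∈ L ∩ R₀
    doubly {t} full = x∈p∩q⁺ (lo∈⁻ (full (≈-trans (lo≈ (pair t)) (pair≈ t))) ,
                              hi∈⁻ (full (≈-trans (hi≈ (pair t)) (pair≈ t))))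
    pa≢pb : pair a ≢ pair b
    pa≢pb pa≡pb = a≉b (≈-trans (≈-sym (pair≈ a)) (≈-trans (≡⇒≈ (cong toℕ pa≡pb)) (pair≈ b)))

  AtMostOneFull : Subset N → Set
  AtMostOneFull B = ∀ {a b} → FullPair B a → FullPair B b → a ≈ b

  small-covered⇒AtMostOneFull : ∀ {B} → ∣ B ∣ < n + 2 → Covered B → AtMostOneFull B
  small-covered⇒AtMostOneFull small covered {a} {b} full-a full-b with a ≈? b
  ... | yes a≈b = a≈b
  ... | no a≉b = ⊥-elim (<⇒≱ small (two-full⇒n+2≤∣B∣ covered full-a full-b a≉b))

  Beside : ℕ → Fin N → Set
  Beside s y = toℕ y ≈ s + 1 ⊎ toℕ y ≈ s + m

  +1≉+m : ∀ s → ¬ s + 1 ≈ s + m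
  +1≉+m s s+1≈s+m = +≉ (s + 1) z<s (s≤s (n≤1+n (suc k)))
    (≈-trans (≡⇒≈ (+-assoc s 1 (suc k))) (≈-sym s+1≈s+m))

  beside≉ : ∀ {s y} → Beside s y → ¬ toℕ y ≈ s
  beside≉ {s} (inj₁ y≈) y≈s = +≉ s z<s 1<n (≈-trans (≈-sym y≈) y≈s)
  beside≉ {s} (inj₂ y≈) y≈s = +≉ s z<s (n<1+n m) (≈-trans (≈-sym y≈) y≈s)

  beside-adj : ∀ {u y} → Beside (toℕ u) y → MAdj n u y
  beside-adj y-beside = near⇒adj (λ { refl → beside≉ y-beside (≡⇒≈ refl) }) (inj₂ y-beside)

  beside-white : ∀ {B} s → AtMostOneFull B → ∃ λ y → Beside s y × y ∉ B
  beside-white {B} s one with full-or-white B (s + 1) | full-or-white B (s + m)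
  ... | inj₂ (y , y≈ , y∉B) | _ = y , inj₁ y≈ , y∉B
  ... | inj₁ _ | inj₂ (y , y≈ , y∉B) = y , inj₂ y≈ , y∉B
  ... | inj₁ full₁ | inj₁ fullₘ = ⊥-elim (+1≉+m s (one full₁ fullₘ))

  others-not-full : ∀ {B s} → AtMostOneFull B → FullPair B s → ∀ {d} → 0 < d → d < n → ¬ FullPair B (s + d)
  others-not-full {s = s} one full 0<d d<n full′ = +≉ s 0<d d<n (≈-sym (one full full′))

  arc-connected : ∀ {B s x y} → AtMostOneFull B → FullPair B s →
        x ∉ B → toℕ x ≈ s + 1 → y ∉ B → toℕ y ≈ s + m → SameComp B x y
  arc-connected {B} {s} one full x∉B x≈ y∉B y≈ =
    pair-path (suc k) unfull x∉B x≈ y∉B (≈-trans y≈ (≡⇒≈ (sym (+-assoc s 1 (suc k)))))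
    where
    unfull : ∀ {i} → i ≤ suc k → ¬ FullPair B (s + 1 + i)
    unfull {i} i≤ = others-not-full one full z<s (s≤s (s≤s i≤)) ∘ FullPair-resp (≡⇒≈ (+-assoc s 1 i))

  no-force : ∀ {B u w} → AtMostOneFull B → ¬ Forces B u w
  no-force {B} {u} {w} one f@(u∈B , w∉B , u~w , _) = [ full-pair , white-twin ] (full-or-white B (toℕ u))
    where
    rival : ∀ {y} → y ≢ w → y ∉ B → MAdj n u y → SameComp B w y → ⊥
    rival y≢w y∉B u~y w⇝y = ¬Forces-rival y≢w y∉B u~y w⇝y f

    white-twin : (∃ λ y → toℕ y ≈ toℕ u × y ∉ B) → ⊥
    white-twin (y , y≈u , y∉B) with y ≟ᶠ w
    ... | no y≢w = rival y≢w y∉B (near⇒adj (λ { refl → y∉B u∈B }) (inj₁ y≈u))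
                     (white-edge w∉B y∉B (adj-resp-≈ (adj-sym u~w) (y≢w ∘ sym) y≈u))
    ... | yes refl with beside-white (toℕ u) one
    ...   | z , z-beside , z∉B = rival z≢w z∉B (beside-adj z-beside)
              (white-edge w∉B z∉B (adj-sym (adj-resp-≈ (adj-sym (beside-adj z-beside)) z≢w y≈u)))
      where
      z≢w : z ≢ y
      z≢w refl = beside≉ z-beside y≈u

    full-pair : FullPair B (toℕ u) → ⊥
    full-pair full with adj⇒near u~w
    ... | inj₁ w≈u = w∉B (full w≈u)
    ... | inj₂ (inj₁ w≈u+1) with white-in-pair (others-not-full one full z<s (n<1+n m))
    ...   | z , z≈ , z∉B = rival (λ { refl → +1≉+m (toℕ u) (≈-trans (≈-sym w≈u+1) z≈) }) z∉B
                             (beside-adj (inj₂ z≈)) (arc-connected one full w∉B w≈u+1 z∉B z≈)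
    full-pair full | inj₂ (inj₂ w≈u+m) with white-in-pair (others-not-full one full z<s 1<n)
    ...   | z , z≈ , z∉B = rival (λ { refl → +1≉+m (toℕ u) (≈-trans (≈-sym z≈) w≈u+m) }) z∉B
                             (beside-adj (inj₁ z≈)) (SameComp-sym adj-sym (arc-connected one full z∉B z≈ w∉B w≈u+m))

  fully-white-or-covered : ∀ B → (∃ λ i → lo i ∉ B × hi i ∉ B) ⊎ Covered B
  fully-white-or-covered B with any? (λ i → ¬? (lo i ∈? B) ×-dec ¬? (hi i ∈? B))
  ... | yes white = inj₁ white
  ... | no ¬white = inj₂ black-member
    where
    black-member : Covered B
    black-member t with lo (pair t) ∈? B | hi (pair t) ∈? B
    ... | yes lo∈ | _ = lo (pair t) , ≈-trans (lo≈ (pair t)) (pair≈ t) , lo∈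
    ... | no _ | yes hi∈ = hi (pair t) , ≈-trans (hi≈ (pair t)) (pair≈ t) , hi∈
    ... | no lo∉ | no hi∉ = ⊥-elim (¬white (pair t , lo∉ , hi∉))

  n+2≤∣⊤∣ : n + 2 ≤ ∣ ⊤ {N} ∣
  n+2≤∣⊤∣ = subst (n + 2 ≤_) (sym (∣⊤∣≡n N)) (+-monoʳ-≤ n (s≤s (s≤s z≤n)))

  lower-bound : ∀ S → IsPZFS S → n + 2 ≤ ∣ S ∣
  lower-bound S forcing with n + 2 ≤? ∣ S ∣ | fully-white-or-covered S
  ... | yes large | _ = large
  ... | no _ | inj₁ (i , lo∉ , hi∉) =
    ⊥-elim (white-twins-never-black (≈⇒Twins (lo≢hi i) hi≈lo) (≈⇒Twins (lo≢hi i ∘ sym) (≈-sym hi≈lo))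
                                     lo∉ hi∉ forcing)
    where
    hi≈lo : toℕ (hi i) ≈ toℕ (lo i)
    hi≈lo = ≈-trans (hi≈ i) (≈-sym (lo≈ i))
  ... | no small | inj₂ covered = ⊥-elim (small (subst (λ B → n + 2 ≤ ∣ B ∣) (sym S≡⊤) n+2≤∣⊤∣))
    where
    S≡⊤ : S ≡ ⊤
    S≡⊤ = no-forces⇒⊤ (no-force (small-covered⇒AtMostOneFull (≰⇒> small) covered)) forcing

  near-1+j⇒≤ : ∀ {j a} → 2 + j < n → a < N → Near (1 + j) a → a ≤ 2 + j + n
  near-1+j⇒≤ {j} {a} 2+j<n a<N = bound
    where
    c = 2 + j + n
    pair-before : ∀ {b} → b < 2 + j → a ≈ b → a ≤ c
    pair-before b<2+j a≈b with ≈-cases a<N (<-trans b<2+j 2+j<n) a≈b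
    ... | inj₁ refl = ≤-trans (n≤1+n _) (≤-trans b<2+j (m≤m+n (2 + j) n))
    ... | inj₂ refl = <⇒≤ (subst (_< c) (+-comm _ n) (+-monoˡ-< n b<2+j))
    bound : Near (1 + j) a → a ≤ c
    bound (inj₁ a≈1+j) = pair-before (n<1+n (1 + j)) a≈1+j
    bound (inj₂ (inj₁ a≈1+j+1)) with ≈-cases a<N 2+j<n (≈-trans a≈1+j+1 (≡⇒≈ (+-comm (1 + j) 1)))
    ... | inj₁ refl = m≤m+n (2 + j) n
    ... | inj₂ refl = ≤-reflexive (+-comm n (2 + j))
    bound (inj₂ (inj₂ a≈1+j+m)) =
      pair-before (n≤1+n (suc j)) (≈-trans a≈1+j+m (≈-trans (≡⇒≈ (sym (+-suc j m))) (+n≈ j)))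

  forcing-step : ∀ {j} → 2 + j + n < N → Step (below N (2 + j + n)) (below N (suc (2 + j + n)))
  forcing-step {j} c<N = u , w , (u∈ , w∉ , u~w , unique) , below-suc w toℕ-w
    where
    c = 2 + j + n
    1+j<c : 1 + j < c
    1+j<c = m≤m+n (2 + j) n
    u w : Fin N
    u = fromℕ< (<-trans 1+j<c c<N)
    w = fromℕ< c<N
    toℕ-u : toℕ u ≡ 1 + j
    toℕ-u = toℕ-fromℕ< (<-trans 1+j<c c<N)
    toℕ-w : toℕ w ≡ c
    toℕ-w = toℕ-fromℕ< c<N
    u∈ : u ∈ below N c
    u∈ = ∈below (subst (_< c) (sym toℕ-u) 1+j<c)
    w∉ : w ∉ below N c
    w∉ w∈ = <-irrefl refl (subst (_< c) toℕ-w (∈below⁻ w∈))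
    u~w : MAdj n u w
    u~w = near⇒adj (λ u≡w → <⇒≢ 1+j<c (trans (sym toℕ-u) (trans (cong toℕ u≡w) toℕ-w)))
                   (inj₂ (inj₁ (≈-trans (≡⇒≈ toℕ-w) (≈-trans (+n≈ (2 + j))
                                (≡⇒≈ (trans (+-comm 1 (1 + j)) (cong (_+ 1) (sym toℕ-u))))))))
    2+j<n : 2 + j < n
    2+j<n = +-cancelʳ-< n (2 + j) n (subst (c <_) (cong (n +_) (+-identityʳ n)) c<N)
    unique : ∀ w′ → w′ ∉ below N c → MAdj n u w′ → SameComp (below N c) w w′ → w′ ≡ w
    unique w′ w′∉ u~w′ _ = toℕ-injective (trans (≤-antisym w′≤c (≮⇒≥ (w′∉ ∘ ∈below))) (sym toℕ-w))
      where
      w′≤c : toℕ w′ ≤ c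
      w′≤c = near-1+j⇒≤ 2+j<n (toℕ<n w′) (subst (λ a → Near a (toℕ w′)) toℕ-u (adj⇒near u~w′))

  forcing-chain : ∀ r j → 2 + j + n + r ≡ N → Star Step (below N (2 + j + n)) ⊤
  forcing-chain zero j c+0≡N =
    subst (λ c → Star Step (below N c) ⊤) (sym (trans (sym (+-identityʳ (2 + j + n))) c+0≡N))
          (subst (λ B → Star Step B ⊤) (sym (below-all N)) ε)
  forcing-chain (suc r) j c+r≡N =
    forcing-step c<N ◅ forcing-chain r (suc j) (trans (sym (+-suc (2 + j + n) r)) c+r≡N)
    where
    c<N : 2 + j + n < N
    c<N = subst (2 + j + n <_) c+r≡N (m<m+n (2 + j + n) z<s)

  2+n+[1+k]≡N : 2 + n + suc k ≡ N
  2+n+[1+k]≡N = identity k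
    where
    identity : ∀ k → 2 + (3 + k) + suc k ≡ 2 * (3 + k)
    identity = solve-∀

  upper-bound : ∃ λ S → IsPZFS S × ∣ S ∣ ≡ n + 2
  upper-bound = below N (2 + n) , forcing-chain (suc k) 0 2+n+[1+k]≡N ,
                trans (∣below∣ (subst (2 + n ≤_) 2+n+[1+k]≡N (m≤m+n (2 + n) (suc k)))) (+-comm 2 n)

lemma11p4 : (n : ℕ) → 3 ≤ n → PZF.ZPlusIs (MAdj n) (n + 2)
lemma11p4 (suc (suc (suc k))) _ = Musical.upper-bound k , Musical.lower-bound k
lemma11p4 (suc (suc zero)) (s≤s (s≤s ()))
lemma11p4 (suc zero) (s≤s ())
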